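{- Let $O$ be a finite set of indivisible objects and let $n\ge 2$ agents have additive valuations $V_1,\dots,V_n:2^O\to\mathbb{R}_{\ge0}$. Then there is a protocol that partitions all objects, $O=Z_1\,\dot\cup\cdots\dot\cup\,Z_n$, such that $V_i(Z_i)\ge \mathrm{MMS}_i^{1\text{ -out-of- }(2n-2)}(O)$ for every agent $i$.
   Context: For an agent $i$ and integers $1\le l\le d$, the $l$-out-of-$d$ maximin share of $i$ from $O$ is $\mathrm{MMS}_i^{l\text{ -out-of- }d}(O):=\max_{\mathbf{P}}\min_{Z}V_i(Z)$, where the maximum ranges over all partitions $\mathbf{P}$ of $O$ into $d$ (possibly empty) subsets and the minimum over all unions $Z$ of $l$ distinct subsets of $\mathbf{P}$. The protocol interacts with agents via queries about their own valuations.
   Formalization: The additive valuations $V_1,\dots,V_n$ are determined by nonnegative rational values of the single objects rather than real ones. -}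

module Defs where

open import Data.Nat using (ℕ; zero; suc)
open import Data.Bool using (Bool; true; false; if_then_else_)
open import Data.Fin using (Fin; zero; suc; _≟_)
open import Data.Fin.Subset using (Subset; ∣_∣)
open import Data.Vec using (lookup)
open import Data.Rational using (ℚ; 0ℚ; _+_; _≤_)
open import Data.Product using (Σ; _×_)
open import Relation.Binary.PropositionalEquality using (_≡_)
open import Relation.Nullary.Decidable using (⌊_⌋)

-- Objects are O = Fin m.  A set of objects is given by its indicator
-- function Fin m → Bool.

sumFin : ∀ {m} → (Fin m → ℚ) → ℚ
sumFin {zero}  f = 0ℚ
sumFin {suc m} f = f zero + sumFin (λ j → f (suc j))

V : ∀ {m} → (Fin m → ℚ) → (Fin m → Bool) → ℚ
V v Z = sumFin (λ j → if Z j then v j else 0ℚ)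

-- A partition of O = Fin m into d (possibly empty) labelled bundles is an
-- assignment P : Fin m → Fin d; bundle k is { j | P j ≡ k }.
bundle : ∀ {m d} → (Fin m → Fin d) → Fin d → (Fin m → Bool)
bundle P k j = ⌊ P j ≟ k ⌋

unionOf : ∀ {m d} → (Fin m → Fin d) → Subset d → (Fin m → Bool)
unionOf P S j = lookup S (P j)

-- MMS-≤ l d v x  means  MMS^{l-out-of-d}(O) ≤ x  for the valuation v,
-- i.e. (unfolding max/min over finitely many options): for every
-- partition P of O into d subsets there is a union Z of l distinct
-- subsets of P with V(Z) ≤ x.
MMS-≤ : ∀ {m} → ℕ → (d : ℕ) → (Fin m → ℚ) → ℚ → Set
MMS-≤ {m} l d v x =
  (P : Fin m → Fin d) → Σ (Subset d) λ S → (∣ S ∣ ≡ l) × (V v (unionOf P S) ≤ x)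

-- Every agent i fixes a partition into 2n − 2 pieces each worth at
-- least μᵢ, its maximin share.  While some agent values a set of at most two
-- remaining objects at μᵢ or more, it receives that set; since its pieces are
-- disjoint, every other agent loses at most two of them, so k remaining agents
-- always keep 2k − 2 intact pieces.  With two agents left, cut-and-choose on two
-- pieces of one of them finishes.  Otherwise any two remaining objects are worth
-- less than μᵢ to everybody and bag filling finishes: objects are put into a bag
-- one at a time until somebody likes it, so to the others a bag is worth at most
-- μᵢ plus one of its objects.  Hence the first two bags cost an agent at most 3μᵢ
-- and each later one at most 2μᵢ, which the reserve (2k − 2)μᵢ covers.
module Submission where

open import Defs
open import Data.Nat using (ℕ; _≤_; _*_; _∸_)
open import Data.Fin using (Fin)
open import Data.Rational using (ℚ; 0ℚ) renaming (_≤_ to _≤ℚ_)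
open import Data.Product using (Σ)

import Data.Rational.Properties as ℚ
open import Algebra.Bundles using (CommutativeMonoid)
open import Algebra.Definitions.RawMonoid Data.Rational.+-0-rawMonoid using () renaming (_×_ to _·_)
import Algebra.Properties.CommutativeMonoid.Sum ℚ.+-0-commutativeMonoid as Sum
open import Algebra.Properties.CommutativeSemigroup
  (CommutativeMonoid.commutativeSemigroup ℚ.+-0-commutativeMonoid) using (xy∙z≈xz∙y)
open import Data.Bool using (Bool; true; false; if_then_else_; _∧_; _∨_; not)
import Data.Bool.Properties as Bool
open import Data.Empty using (⊥-elim)
open import Data.Fin using (zero; suc; _≟_; finToFun; funToFin)
import Data.Fin.Properties as Fin
import Data.Fin.Subset as Subset
open import Data.Fin.Subset.Properties using (∣⁅x⁆∣≡1)
open import Data.List using (List; []; _∷_; length; filter; allFin; tabulate)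
open import Data.List.Properties using (filter-all; length-removeAt; length-tabulate)
open import Data.List.Membership.Propositional using (_∈_; lose)
open import Data.List.Membership.Propositional.Properties using (∈-allFin)
open import Data.List.Relation.Unary.All as All using (All; []; _∷_)
import Data.List.Relation.Unary.All.Properties as All
open import Data.List.Relation.Unary.All.Properties using (─⁻; ─⁺; ¬Any⇒All¬)
open import Data.List.Relation.Unary.AllPairs using (AllPairs; []; _∷_)
import Data.List.Relation.Unary.AllPairs.Properties as AllPairs
open import Data.List.Relation.Unary.Any as Any using (Any; here; there; _─_)
open import Data.List.Relation.Unary.Any.Properties using (lookup-result)
open import Data.Nat as ℕ using (zero; suc; s≤s; z≤n; _^_)
import Data.Nat.Properties as ℕ
open import Data.Product using (_×_; _,_; proj₁; proj₂; map₂)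
open import Data.Rational using (_+_; _<_)
open import Data.Sum using (_⊎_; inj₁; inj₂)
open import Data.Vec using (lookup)
open import Data.Vec.Properties using (lookup-replicate)
open import Function using (_∘_)
open import Relation.Binary.Bundles using (DecTotalOrder)
open import Relation.Binary.PropositionalEquality
  using (_≡_; _≢_; _≗_; refl; sym; trans; cong; cong₂; subst; module ≡-Reasoning)
open import Relation.Nullary using (¬_; Dec; yes; no; does; contradiction)
open import Relation.Nullary.Decidable using (isYes; isYes≗does; dec-true; dec-false; _×-dec_)
open import Relation.Unary using (Decidable)

-- Bundles of objects

Bundle : ℕ → Set
Bundle m = Fin m → Bool

module _ {m : ℕ} where

  infixr 7 _∩_
  infixr 6 _∪_ _∖_
  infix  4 _⊆_

  _⊆_ : Bundle m → Bundle m → Set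
  Z ⊆ W = ∀ o → Z o ≡ true → W o ≡ true

  _∩_ _∪_ _∖_ : Bundle m → Bundle m → Bundle m
  (Z ∩ W) o = Z o ∧ W o
  (Z ∪ W) o = Z o ∨ W o
  (Z ∖ W) o = Z o ∧ not (W o)

  ∅ full : Bundle m
  ∅ _ = false
  full _ = true

  -- `does` rather than `isYes` (used by `bundle`), as it computes through `suc o ≟ suc x`.
  ⁅_⁆ : Fin m → Bundle m
  ⁅ x ⁆ o = does (o ≟ x)

  Disjoint : Bundle m → Bundle m → Set
  Disjoint Z W = ∀ o → Z o ≡ true → W o ≡ false

  ⊆⇒∩≗ : ∀ {Z W} → Z ⊆ W → W ∩ Z ≗ Z
  ⊆⇒∩≗ {Z} {W} Z⊆W o with Z o in z
  ... | true  = cong (_∧ true) (Z⊆W o z)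
  ... | false = Bool.∧-zeroʳ (W o)

  ⁅⁆-self : ∀ x → ⁅ x ⁆ x ≡ true
  ⁅⁆-self x = dec-true (x ≟ x) refl

  ⊆-∖ : ∀ {R Q Q′} → Disjoint Q Q′ → Q′ ⊆ R → Q′ ⊆ R ∖ Q
  ⊆-∖ {R} {Q} Q#Q′ Q′⊆R o Q′o with Q o in Qo
  ... | true  = contradiction (trans (sym Q′o) (Q#Q′ o Qo)) λ ()
  ... | false = trans (Bool.∧-identityʳ (R o)) (Q′⊆R o Q′o)

  ⁅⁆-⊆ : ∀ {R x} → R x ≡ true → ⁅ x ⁆ ⊆ R
  ⁅⁆-⊆ {x = x} Rx o h with o ≟ x
  ⁅⁆-⊆ Rx o h  | yes refl = Rx
  ⁅⁆-⊆ Rx o () | no  _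

  ⁅⁆∪-⊆ : ∀ {R C x} → R x ≡ true → C ⊆ R → ⁅ x ⁆ ∪ C ⊆ R
  ⁅⁆∪-⊆ {x = x} Rx C⊆R o h with o ≟ x
  ... | yes refl = Rx
  ... | no  _    = C⊆R o h

  avoids-⁅⁆∪⁅⁆ : ∀ {Q x y} → Q x ≡ false → Q y ≡ false → Disjoint (⁅ x ⁆ ∪ ⁅ y ⁆) Q
  avoids-⁅⁆∪⁅⁆ {x = x} {y} Qx Qy o h with o ≟ x | o ≟ y
  avoids-⁅⁆∪⁅⁆ Qx Qy o h  | yes refl | _        = Qx
  avoids-⁅⁆∪⁅⁆ Qx Qy o h  | no  _    | yes refl = Qy
  avoids-⁅⁆∪⁅⁆ Qx Qy o () | no  _    | no  _

  bundle-disjoint : ∀ {d} {P : Fin m → Fin d} {k k′} → k ≢ k′ → Disjoint (bundle P k) (bundle P k′)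
  bundle-disjoint {P = P} {k} {k′} k≢k′ o h with P o ≟ k | P o ≟ k′
  ... | yes Po≡k | yes Po≡k′ = contradiction (trans (sym Po≡k) Po≡k′) k≢k′
  ... | yes _    | no  _     = refl
  bundle-disjoint k≢k′ o () | no _ | _

  Covers : Bundle m → Bundle m → List (Fin m) → Set
  Covers R C js = ∀ o → R o ≡ true → C o ≡ false → o ∈ js

  covers-skip : ∀ {R C j js} → ¬ (R j ≡ true × C j ≡ false) → Covers R C (j ∷ js) → Covers R C js
  covers-skip j∉R∖C cover o Ro Co with cover o Ro Co
  ... | here refl  = contradiction (Ro , Co) j∉R∖C
  ... | there o∈js = o∈js

  covers-insert : ∀ {R C j js} → Covers R C (j ∷ js) → Covers R (⁅ j ⁆ ∪ C) js
  covers-insert {j = j} cover o Ro h with cover o Ro (Bool.∨-conicalʳ _ _ h)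
  ... | here refl  = contradiction (trans (sym (⁅⁆-self j)) (Bool.∨-conicalˡ _ _ h)) λ ()
  ... | there o∈js = o∈js

  avoids? : ∀ x → Decidable (λ (Q : Bundle m) → Q x ≡ false)
  avoids? x Q = Q x Bool.≟ false

  length-avoiding : ∀ x {Qs} → AllPairs Disjoint Qs →
                    length Qs ≤ suc (length (filter (avoids? x) Qs))
  length-avoiding x {[]}     []           = z≤n
  length-avoiding x {Q ∷ Qs} (Q#Qs ∷ disj) with Q x in Qx
  ... | true  = s≤s (ℕ.≤-reflexive (sym (cong length
                  (filter-all (avoids? x) (All.map (λ Q#Q′ → Q#Q′ x Qx) Q#Qs)))))
  ... | false = s≤s (length-avoiding x disj)

-- Additive valuations

sumFin≡sum : ∀ {m} (f : Fin m → ℚ) → sumFin f ≡ Sum.sum f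
sumFin≡sum {zero}  f = refl
sumFin≡sum {suc m} f = cong (f zero +_) (sumFin≡sum (f ∘ suc))

sumFin-cong : ∀ {m} {f g : Fin m → ℚ} → f ≗ g → sumFin f ≡ sumFin g
sumFin-cong {f = f} {g} f≗g = trans (sumFin≡sum f) (trans (Sum.sum-cong-≗ f≗g) (sym (sumFin≡sum g)))

sumFin-+ : ∀ {m} (f g : Fin m → ℚ) → sumFin (λ o → f o + g o) ≡ sumFin f + sumFin g
sumFin-+ {m} f g = begin
  sumFin (λ o → f o + g o)      ≡⟨ sumFin≡sum (λ o → f o + g o) ⟩
  Sum.sum {m} (λ o → f o + g o) ≡⟨ Sum.∑-distrib-+ f g ⟩
  Sum.sum f + Sum.sum g         ≡⟨ sym (cong₂ _+_ (sumFin≡sum f) (sumFin≡sum g)) ⟩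
  sumFin f + sumFin g           ∎
  where open ≡-Reasoning

sumFin-zero : ∀ m → sumFin {m} (λ _ → 0ℚ) ≡ 0ℚ
sumFin-zero m = trans (sumFin≡sum {m} (λ _ → 0ℚ)) (Sum.sum-replicate-zero m)

sumFin-mono : ∀ {m} {f g : Fin m → ℚ} → (∀ o → f o ≤ℚ g o) → sumFin f ≤ℚ sumFin g
sumFin-mono {zero}  f≤g = ℚ.≤-refl
sumFin-mono {suc m} f≤g = ℚ.+-mono-≤ (f≤g zero) (sumFin-mono (f≤g ∘ suc))

V-⁅⁆ : ∀ {m} (v : Fin m → ℚ) x → V v ⁅ x ⁆ ≡ v x
V-⁅⁆ {suc m} v zero = trans (cong (v zero +_) (sumFin-zero m)) (ℚ.+-identityʳ (v zero))
V-⁅⁆ {suc m} v (suc x) = trans (ℚ.+-identityˡ _) (V-⁅⁆ (v ∘ suc) x)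

module _ {m : ℕ} (v : Fin m → ℚ) where

  V-cong : ∀ {Z W} → Z ≗ W → V v Z ≡ V v W
  V-cong Z≗W = sumFin-cong (λ o → cong (λ b → if b then v o else 0ℚ) (Z≗W o))

  V-∅ : V v ∅ ≡ 0ℚ
  V-∅ = sumFin-zero m

  V-split : ∀ R B → V v R ≡ V v (R ∩ B) + V v (R ∖ B)
  V-split R B = trans (sumFin-cong pointwise) (sumFin-+ {m} _ _)
    where
    pointwise : ∀ o → (if R o then v o else 0ℚ)
                    ≡ (if (R ∩ B) o then v o else 0ℚ) + (if (R ∖ B) o then v o else 0ℚ)
    pointwise o with R o | B o
    ... | true  | true  = sym (ℚ.+-identityʳ (v o))
    ... | true  | false = sym (ℚ.+-identityˡ (v o))
    ... | false | _     = sym (ℚ.+-identityˡ 0ℚ)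

  V-split-⊆ : ∀ {R B} → B ⊆ R → V v R ≡ V v B + V v (R ∖ B)
  V-split-⊆ {R} {B} B⊆R = trans (V-split R B) (cong (_+ V v (R ∖ B)) (V-cong (⊆⇒∩≗ B⊆R)))

  V-insert : ∀ {x C} → C x ≡ false → V v (⁅ x ⁆ ∪ C) ≡ v x + V v C
  V-insert {x} {C} Cx≡false = begin
    V v (⁅ x ⁆ ∪ C)                                         ≡⟨ V-split (⁅ x ⁆ ∪ C) ⁅ x ⁆ ⟩
    V v ((⁅ x ⁆ ∪ C) ∩ ⁅ x ⁆) + V v ((⁅ x ⁆ ∪ C) ∖ ⁅ x ⁆)  ≡⟨ cong₂ _+_ (V-cong on-x) (V-cong off-x) ⟩
    V v ⁅ x ⁆ + V v C                                       ≡⟨ cong (_+ V v C) (V-⁅⁆ v x) ⟩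
    v x + V v C                                             ∎
    where
    open ≡-Reasoning
    on-x : (⁅ x ⁆ ∪ C) ∩ ⁅ x ⁆ ≗ ⁅ x ⁆
    on-x o with does (o ≟ x)
    ... | true  = refl
    ... | false = Bool.∧-zeroʳ (C o)
    off-x : (⁅ x ⁆ ∪ C) ∖ ⁅ x ⁆ ≗ C
    off-x o with o ≟ x
    ... | yes refl = sym Cx≡false
    ... | no  _    = Bool.∧-identityʳ (C o)

  V-pair : ∀ {x y} → x ≢ y → V v (⁅ x ⁆ ∪ ⁅ y ⁆) ≡ v x + v y
  V-pair {x} {y} x≢y = trans (V-insert (dec-false (x ≟ y) x≢y)) (cong (v x +_) (V-⁅⁆ v y))

  V-pair-self : ∀ x → V v (⁅ x ⁆ ∪ ⁅ x ⁆) ≡ v x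
  V-pair-self x = trans (V-cong (λ o → Bool.∨-idem (⁅ x ⁆ o))) (V-⁅⁆ v x)

+-cancelˡ-≤ : ∀ a {x y} → a + x ≤ℚ a + y → x ≤ℚ y
+-cancelˡ-≤ a {x} {y} a+x≤a+y with x ℚ.≤? y
... | yes x≤y = x≤y
... | no  x≰y = ⊥-elim (ℚ.<-irrefl refl (ℚ.<-≤-trans (ℚ.+-monoʳ-< a (ℚ.≰⇒> x≰y)) a+x≤a+y))

+-cancel-≤-dominated : ∀ {a t x y} → x ≤ℚ a → a + t ≤ℚ x + y → t ≤ℚ y
+-cancel-≤-dominated {a} {y = y} x≤a h = +-cancelˡ-≤ a (ℚ.≤-trans h (ℚ.+-monoˡ-≤ y x≤a))

p≤p+q : ∀ {p q} → 0ℚ ≤ℚ q → p ≤ℚ p + q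
p≤p+q {p} {q} 0≤q = subst (_≤ℚ p + q) (ℚ.+-identityʳ p) (ℚ.+-monoʳ-≤ p 0≤q)

·-nonneg : ∀ n {x} → 0ℚ ≤ℚ x → 0ℚ ≤ℚ n · x
·-nonneg zero    0≤x = ℚ.≤-refl
·-nonneg (suc n) 0≤x = ℚ.≤-trans 0≤x (p≤p+q (·-nonneg n 0≤x))

·-monoˡ-≤ : ∀ {m n x} → 0ℚ ≤ℚ x → m ≤ n → m · x ≤ℚ n · x
·-monoˡ-≤ {n = n} 0≤x z≤n       = ·-nonneg n 0≤x
·-monoˡ-≤ {x = x} 0≤x (s≤s m≤n) = ℚ.+-monoʳ-≤ x (·-monoˡ-≤ 0≤x m≤n)

module _ {m : ℕ} {v : Fin m → ℚ} (v≥0 : ∀ o → 0ℚ ≤ℚ v o) where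

  V-mono : ∀ {Z W} → Z ⊆ W → V v Z ≤ℚ V v W
  V-mono {Z} {W} Z⊆W = sumFin-mono pointwise
    where
    pointwise : ∀ o → (if Z o then v o else 0ℚ) ≤ℚ (if W o then v o else 0ℚ)
    pointwise o with Z o in Zo
    ... | true rewrite Z⊆W o Zo = ℚ.≤-refl
    ... | false with W o
    ...   | true  = v≥0 o
    ...   | false = ℚ.≤-refl

  V-nonneg : ∀ Z → 0ℚ ≤ℚ V v Z
  V-nonneg Z = subst (_≤ℚ V v Z) (V-∅ v) (V-mono (λ _ ()))

  packing-bound : ∀ {R c} Qs → AllPairs Disjoint Qs → All (_⊆ R) Qs →
                  All (λ Q → c ≤ℚ V v Q) Qs → length Qs · c ≤ℚ V v R
  packing-bound {R} []       []            []            []           = V-nonneg R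
  packing-bound {R} (Q ∷ Qs) (Q#Qs ∷ disj) (Q⊆R ∷ Qs⊆R) (c≤Q ∷ c≤Qs) = ℚ.≤-trans
    (ℚ.+-mono-≤ c≤Q (packing-bound Qs disj Qs⊆R∖Q c≤Qs)) (ℚ.≤-reflexive (sym (V-split-⊆ v Q⊆R)))
    where
    Qs⊆R∖Q : All (_⊆ R ∖ Q) Qs
    Qs⊆R∖Q = All.zipWith (λ (Q#Q′ , Q′⊆R) → ⊆-∖ Q#Q′ Q′⊆R) (Q#Qs , Qs⊆R)

-- Maximin shares

lookup-⁅⁆ : ∀ {d} (x y : Fin d) → lookup Subset.⁅ y ⁆ x ≡ ⁅ y ⁆ x
lookup-⁅⁆ zero    zero    = refl
lookup-⁅⁆ (suc x) zero    = lookup-replicate x false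
lookup-⁅⁆ zero    (suc y) = refl
lookup-⁅⁆ (suc x) (suc y) = lookup-⁅⁆ x y

module _ {m d : ℕ} (v : Fin m → ℚ) where

  bundle-cong : ∀ {P P′ : Fin m → Fin d} → P ≗ P′ → ∀ k → V v (bundle P k) ≡ V v (bundle P′ k)
  bundle-cong P≗P′ k = V-cong v (λ o → cong (λ l → isYes (l ≟ k)) (P≗P′ o))

  MMS-≤-intro : ∀ {x} → (∀ P → Σ (Fin d) λ k → V v (bundle P k) ≤ℚ x) → MMS-≤ 1 d v x
  MMS-≤-intro {x} poor P with poor P
  ... | k , Pk≤x = Subset.⁅ k ⁆ , ∣⁅x⁆∣≡1 k , subst (_≤ℚ x) (V-cong v bundle≗union) Pk≤x
    where
    bundle≗union : bundle P k ≗ unionOf P Subset.⁅ k ⁆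
    bundle≗union o = trans (isYes≗does (P o ≟ k)) (sym (lookup-⁅⁆ (P o) k))

module Maximin {m d : ℕ} (v : Fin m → ℚ) (k₀ : Fin d) where

  open import Data.List.Extrema (DecTotalOrder.totalOrder ℚ.≤-decTotalOrder)
    using (argmin; argmax; f[argmin]≤f[xs]; f[xs]≤f[argmax])

  poorest : (Fin m → Fin d) → Fin d
  poorest P = argmin (λ k → V v (bundle P k)) k₀ (allFin d)

  poorest-value : (Fin m → Fin d) → ℚ
  poorest-value P = V v (bundle P (poorest P))

  poorest-≤ : ∀ P k → poorest-value P ≤ℚ V v (bundle P k)
  poorest-≤ P k = All.lookup (f[argmin]≤f[xs] k₀ (allFin d)) (∈-allFin k)

  -- Every partition agrees pointwise with `decode (funToFin P)`, so maximising over the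
  -- codes maximises over all partitions.
  decode : Fin (d ^ m) → Fin m → Fin d
  decode = finToFun

  maximin : Fin m → Fin d
  maximin = decode (argmax (poorest-value ∘ decode) (funToFin {m} (λ _ → k₀)) (allFin (d ^ m)))

  mms : ℚ
  mms = poorest-value maximin

  mms-≤-maximin : ∀ k → mms ≤ℚ V v (bundle maximin k)
  mms-≤-maximin = poorest-≤ maximin

  mms-bound : ∀ P → Σ (Fin d) λ k → V v (bundle P k) ≤ℚ mms
  mms-bound P = poorest P′ , ℚ.≤-trans (ℚ.≤-reflexive (bundle-cong v P≗P′ (poorest P′)))
    (All.lookup (f[xs]≤f[argmax] {f = poorest-value ∘ decode} _ (allFin (d ^ m))) (∈-allFin (funToFin P)))
    where
    P′ = decode (funToFin P)
    P≗P′ : P ≗ P′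
    P≗P′ o = sym (Fin.finToFun-funToFin P o)

-- The protocol

module Protocol {m n : ℕ} (v : Fin n → Fin m → ℚ) (v≥0 : ∀ i o → 0ℚ ≤ℚ v i o)
                (μ : Fin n → ℚ) (μ≥0 : ∀ i → 0ℚ ≤ℚ μ i) where

  Likes : Fin n → Bundle m → Set
  Likes i B = μ i ≤ℚ V (v i) B

  likes? : ∀ i B → Dec (Likes i B)
  likes? i B = μ i ℚ.≤? V (v i) B

  owned : (Fin m → Fin n) → Fin n → Bundle m
  owned A i = ⁅ i ⁆ ∘ A

  Share : (Fin m → Fin n) → Bundle m → Fin n → Set
  Share A R i = Likes i (R ∩ owned A i)

  Allocation : List (Fin n) → Bundle m → Set
  Allocation L R = Σ (Fin m → Fin n) λ A → All (Share A R) L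

  override : Bundle m → Fin n → (Fin m → Fin n) → Fin m → Fin n
  override B a A o = if B o then a else A o

  lone : ∀ {i R} → Likes i R → Allocation (i ∷ []) R
  lone {i} {R} i⊒R = (λ _ → i) , ℚ.≤-trans i⊒R (V-mono (v≥0 i) R⊆owned) ∷ []
    where
    R⊆owned : R ⊆ R ∩ owned (λ _ → i) i
    R⊆owned o Ro rewrite Ro = ⁅⁆-self i

  assign : ∀ {L R B} (p : Any (λ i → Likes i B) L) → B ⊆ R →
           Allocation (L ─ p) (R ∖ B) → Allocation L R
  assign {L} {R} {B} p B⊆R (A , shares) = A′ , ─⁻ p received (All.map kept shares)
    where
    a = Any.lookup p
    A′ = override B a A
    received : Share A′ R a
    received = ℚ.≤-trans (lookup-result p) (V-mono (v≥0 a) B⊆owned)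
      where
      B⊆owned : B ⊆ R ∩ owned A′ a
      B⊆owned o Bo rewrite B⊆R o Bo | Bo = ⁅⁆-self a
    kept : ∀ {i} → Share A (R ∖ B) i → Share A′ R i
    kept {i} i⊒ = ℚ.≤-trans i⊒ (V-mono (v≥0 i) still-owned)
      where
      still-owned : (R ∖ B) ∩ owned A i ⊆ R ∩ owned A′ i
      still-owned o h  with R o | B o
      still-owned o h  | true  | false = h
      still-owned o () | true  | true
      still-owned o () | false | _

  record Pieces (i : Fin n) (R : Bundle m) (t : ℕ) : Set where
    constructor pieces
    field
      parts    : List (Bundle m)
      disjoint : AllPairs Disjoint parts
      inside   : All (_⊆ R) parts
      liked    : All (Likes i) parts
      enough   : t ≤ length parts

  partition-pieces : ∀ {i d} (P : Fin m → Fin d) → (∀ k → Likes i (bundle P k)) → Pieces i full d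
  partition-pieces P liked = pieces (tabulate (bundle P)) (AllPairs.tabulate⁺ bundle-disjoint)
    (All.tabulate⁺ λ _ _ _ → refl) (All.tabulate⁺ liked) (ℕ.≤-reflexive (sym (length-tabulate (bundle P))))

  pieces-value : ∀ {i R t} → Pieces i R t → t · μ i ≤ℚ V (v i) R
  pieces-value {i} (pieces Qs disj inside liked enough) =
    ℚ.≤-trans (·-monoˡ-≤ (μ≥0 i) enough) (packing-bound (v≥0 i) Qs disj inside liked)

  pieces-avoiding : ∀ {i R t} → Pieces i R (2 ℕ.+ t) → ∀ x y → Pieces i (R ∖ (⁅ x ⁆ ∪ ⁅ y ⁆)) t
  pieces-avoiding {R = R} {t} (pieces Qs disj inside liked enough) x y =
    pieces Qs″ (AllPairs.filter⁺ _ (AllPairs.filter⁺ _ disj)) inside″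
           (All.filter⁺ _ (All.filter⁺ _ liked)) enough″
    where
    Qs′ = filter (avoids? x) Qs
    Qs″ = filter (avoids? y) Qs′
    enough″ : t ≤ length Qs″
    enough″ = ℕ.≤-pred (ℕ.≤-pred (ℕ.≤-trans enough (ℕ.≤-trans (length-avoiding x disj)
                (s≤s (length-avoiding y (AllPairs.filter⁺ _ disj))))))
    inside″ : All (_⊆ R ∖ (⁅ x ⁆ ∪ ⁅ y ⁆)) Qs″
    inside″ = All.zipWith (λ ((Q⊆R , Qx) , Qy) → ⊆-∖ (avoids-⁅⁆∪⁅⁆ Qx Qy) Q⊆R)
      ( All.filter⁺ _ (All.zip (All.filter⁺ _ inside , All.all-filter (avoids? x) Qs))
      , All.all-filter (avoids? y) Qs′)

  cut-and-choose : ∀ {a b R} → Pieces a R 2 → Pieces b R 2 → Allocation (a ∷ b ∷ []) R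
  cut-and-choose (pieces []          _ _ _ ())
  cut-and-choose (pieces (_ ∷ [])    _ _ _ (s≤s ()))
  cut-and-choose {a} {b} {R}
    (pieces (Q₁ ∷ Q₂ ∷ _) ((Q₁#Q₂ ∷ _) ∷ _) (Q₁⊆R ∷ Q₂⊆R ∷ _) (a⊒Q₁ ∷ a⊒Q₂ ∷ _) _) pb
    with likes? b Q₁
  ... | yes b⊒Q₁ = assign (there (here b⊒Q₁)) Q₁⊆R
                     (lone (ℚ.≤-trans a⊒Q₂ (V-mono (v≥0 a) (⊆-∖ Q₁#Q₂ Q₂⊆R))))
  ... | no  b⋣Q₁ = assign (here a⊒Q₁) Q₁⊆R (lone b⊒rest)
    where
    b⊒rest : Likes b (R ∖ Q₁)
    b⊒rest = subst (_≤ℚ _) (ℚ.+-identityʳ (μ b))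
      (+-cancel-≤-dominated (ℚ.<⇒≤ (ℚ.≰⇒> b⋣Q₁))
        (ℚ.≤-trans (pieces-value pb) (ℚ.≤-reflexive (V-split-⊆ (v b) Q₁⊆R))))

  BagBound : Fin n → Bundle m → Set
  BagBound i B = V (v i) B ≤ℚ μ i ⊎ Σ (Fin m) λ ℓ → B ℓ ≡ true × V (v i) B ≤ℚ μ i + v i ℓ

  insert-bounded : ∀ {i j C} → C j ≡ false → ¬ Likes i C → BagBound i (⁅ j ⁆ ∪ C)
  insert-bounded {i} {j} {C} Cj i⋣C = inj₂ (j , cong (_∨ C j) (⁅⁆-self j) , (begin
    V (v i) (⁅ j ⁆ ∪ C)  ≡⟨ V-insert (v i) Cj ⟩
    v i j + V (v i) C    ≤⟨ ℚ.+-monoʳ-≤ (v i j) (ℚ.<⇒≤ (ℚ.≰⇒> i⋣C)) ⟩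
    v i j + μ i          ≡⟨ ℚ.+-comm (v i j) (μ i) ⟩
    μ i + v i j          ∎))
    where open ℚ.≤-Reasoning

  record Bag (L : List (Fin n)) (R : Bundle m) : Set where
    field
      bag     : Bundle m
      bag⊆R   : bag ⊆ R
      taker   : Any (λ i → Likes i bag) L
      bounded : All (λ i → BagBound i bag) L

  module _ {L : List (Fin n)} {R : Bundle m} (R-liked : Any (λ i → Likes i R) L) where

    fill : ∀ js C → C ⊆ R → All (λ i → BagBound i C) L → Covers R C js → Bag L R
    fill js C C⊆R bounded cover with Any.any? (λ i → likes? i C) L
    ... | yes taker = record { bag = C ; bag⊆R = C⊆R ; taker = taker ; bounded = bounded }
    fill [] C C⊆R bounded cover | no ¬taker =
      contradiction (Any.map (λ {i} i⊒R → ℚ.≤-trans i⊒R (V-mono (v≥0 i) R⊆C)) R-liked) ¬taker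
      where
      R⊆C : R ⊆ C
      R⊆C o Ro with C o in Co
      ... | true  = refl
      ... | false with () ← cover o Ro Co
    fill (j ∷ js) C C⊆R bounded cover | no ¬taker with R j in Rj | C j in Cj
    ... | true  | false = fill js (⁅ j ⁆ ∪ C) (⁅⁆∪-⊆ Rj C⊆R)
                            (All.map (insert-bounded Cj) (¬Any⇒All¬ L ¬taker)) (covers-insert cover)
    ... | true  | true  = fill js C C⊆R bounded
                            (covers-skip (λ (_ , Cj′) → contradiction (trans (sym Cj′) Cj) λ ()) cover)
    ... | false | _     = fill js C C⊆R bounded
                            (covers-skip (λ (Rj′ , _) → contradiction (trans (sym Rj′) Rj) λ ()) cover)

    find-bag : Bag L R
    find-bag = fill (allFin m) ∅ (λ _ ()) (All.universal empty-bounded L) (λ o _ _ → ∈-allFin o)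
      where
      empty-bounded : ∀ i → BagBound i ∅
      empty-bounded i = inj₁ (subst (_≤ℚ μ i) (sym (V-∅ (v i))) (μ≥0 i))

  module BagFilling (R₀ : Bundle m) where

    Small : Fin n → Set
    Small i = ∀ x y → R₀ x ≡ true → R₀ y ≡ true → V (v i) (⁅ x ⁆ ∪ ⁅ y ⁆) < μ i

    item-≤ : ∀ {i x} → Small i → R₀ x ≡ true → v i x ≤ℚ μ i
    item-≤ {i} {x} small R₀x = ℚ.<⇒≤ (subst (_< μ i) (V-pair-self (v i) x) (small x x R₀x R₀x))

    pair-≤ : ∀ {i x y} → Small i → x ≢ y → R₀ x ≡ true → R₀ y ≡ true → v i x + v i y ≤ℚ μ i
    pair-≤ {i} {x} {y} small x≢y R₀x R₀y = ℚ.<⇒≤ (subst (_< μ i) (V-pair (v i) x≢y) (small x y R₀x R₀y))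

    bag-≤ : ∀ {i B} → Small i → B ⊆ R₀ → BagBound i B → V (v i) B ≤ℚ μ i + μ i
    bag-≤ {i} small B⊆R₀ (inj₁ B≤μ)            = ℚ.≤-trans B≤μ (p≤p+q (μ≥0 i))
    bag-≤ {i} small B⊆R₀ (inj₂ (ℓ , Bℓ , B≤μ+ℓ)) =
      ℚ.≤-trans B≤μ+ℓ (ℚ.+-monoʳ-≤ (μ i) (item-≤ small (B⊆R₀ ℓ Bℓ)))

    bag-≤-pending : ∀ {i B ℓ} → Small i → B ⊆ R₀ → R₀ ℓ ≡ true → B ℓ ≡ false → BagBound i B →
                    V (v i) B + v i ℓ ≤ℚ μ i + μ i
    bag-≤-pending small B⊆R₀ R₀ℓ Bℓ (inj₁ B≤μ) = ℚ.+-mono-≤ B≤μ (item-≤ small R₀ℓ)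
    bag-≤-pending {i} {B} {ℓ} small B⊆R₀ R₀ℓ Bℓ (inj₂ (ℓ′ , Bℓ′ , B≤μ+ℓ′)) = begin
      V (v i) B + v i ℓ         ≤⟨ ℚ.+-monoˡ-≤ (v i ℓ) B≤μ+ℓ′ ⟩
      μ i + v i ℓ′ + v i ℓ      ≡⟨ ℚ.+-assoc (μ i) (v i ℓ′) (v i ℓ) ⟩
      μ i + (v i ℓ′ + v i ℓ)    ≤⟨ ℚ.+-monoʳ-≤ (μ i) (pair-≤ small ℓ′≢ℓ (B⊆R₀ ℓ′ Bℓ′) R₀ℓ) ⟩
      μ i + μ i                 ∎
      where
      open ℚ.≤-Reasoning
      ℓ′≢ℓ : ℓ′ ≢ ℓ
      ℓ′≢ℓ refl = contradiction (trans (sym Bℓ′) Bℓ) λ ()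

    -- Indexed by j when j + 1 agents remain: `settled` means that R is worth (2j + 1)μᵢ,
    -- `pending` that it is worth this together with an object ℓ given away earlier (which,
    -- being small, pairs with any object of the next bag for at most μᵢ), and `fresh`, the
    -- state at the start of bag filling, that R is worth 2jμᵢ.
    data Reserve (i : Fin n) (R : Bundle m) : ℕ → Set where
      settled : ∀ {j} → suc (2 * j) · μ i ≤ℚ V (v i) R → Reserve i R j
      pending : ∀ {j} ℓ → R₀ ℓ ≡ true → R ℓ ≡ false →
                (3 ℕ.+ 2 * j) · μ i ≤ℚ V (v i) R + v i ℓ → Reserve i R (suc j)
      fresh   : ∀ {j} → (4 ℕ.+ 2 * j) · μ i ≤ℚ V (v i) R → Reserve i R (2 ℕ.+ j)

    odd-suc : ∀ j x → suc (2 * suc j) · x ≡ (3 ℕ.+ 2 * j) · x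
    odd-suc j x = cong (λ t → suc t · x) (ℕ.*-suc 2 j)

    reserve-liked : ∀ {i R j} → Small i → Reserve i R (suc j) → Likes i R
    reserve-liked {i} {j = j} small (settled h) = ℚ.≤-trans (p≤p+q (·-nonneg (2 * suc j) (μ≥0 i))) h
    reserve-liked {i} {R} small (pending {j} ℓ R₀ℓ _ h) = ℚ.≤-trans (p≤p+q (·-nonneg (suc (2 * j)) (μ≥0 i)))
      (+-cancel-≤-dominated (item-≤ small R₀ℓ) (ℚ.≤-trans h (ℚ.≤-reflexive (ℚ.+-comm (V (v i) R) (v i ℓ)))))
    reserve-liked {i} small (fresh {j} h) = ℚ.≤-trans (p≤p+q (·-nonneg (3 ℕ.+ 2 * j) (μ≥0 i))) h

    reserve-final : ∀ {i R} → Reserve i R 0 → Likes i R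
    reserve-final {i} (settled h) = subst (_≤ℚ _) (ℚ.+-identityʳ (μ i)) h

    module _ {i R B} (small : Small i) (R⊆R₀ : R ⊆ R₀) (B⊆R : B ⊆ R) where

      open ℚ.≤-Reasoning

      private
        μᵢ = μ i
        VB = V (v i) B
        VR′ = V (v i) (R ∖ B)

      split : V (v i) R ≡ VB + VR′
      split = V-split-⊆ (v i) B⊆R

      B⊆R₀ : B ⊆ R₀
      B⊆R₀ o Bo = R⊆R₀ o (B⊆R o Bo)

      settled-step : ∀ {j} → BagBound i B → suc (2 * suc j) · μᵢ ≤ℚ V (v i) R → suc (2 * j) · μᵢ ≤ℚ VR′
      settled-step {j} bound h = +-cancel-≤-dominated (bag-≤ small B⊆R₀ bound) (begin
        μᵢ + μᵢ + suc (2 * j) · μᵢ  ≡⟨ ℚ.+-assoc μᵢ μᵢ _ ⟩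
        (3 ℕ.+ 2 * j) · μᵢ          ≡⟨ odd-suc j μᵢ ⟨
        suc (2 * suc j) · μᵢ        ≤⟨ h ⟩
        V (v i) R                  ≡⟨ split ⟩
        VB + VR′                   ∎)

      pending-step : ∀ {j ℓ} → BagBound i B → R₀ ℓ ≡ true → R ℓ ≡ false →
                     (3 ℕ.+ 2 * j) · μᵢ ≤ℚ V (v i) R + v i ℓ → suc (2 * j) · μᵢ ≤ℚ VR′
      pending-step {j} {ℓ} bound R₀ℓ Rℓ h = +-cancel-≤-dominated (bag-≤-pending small B⊆R₀ R₀ℓ Bℓ bound) (begin
        μᵢ + μᵢ + suc (2 * j) · μᵢ  ≡⟨ ℚ.+-assoc μᵢ μᵢ _ ⟩
        (3 ℕ.+ 2 * j) · μᵢ          ≤⟨ h ⟩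
        V (v i) R + v i ℓ          ≡⟨ cong (_+ v i ℓ) split ⟩
        VB + VR′ + v i ℓ           ≡⟨ xy∙z≈xz∙y VB VR′ (v i ℓ) ⟩
        VB + v i ℓ + VR′           ∎)
        where
        Bℓ : B ℓ ≡ false
        Bℓ with B ℓ in Bℓ
        ... | true  = contradiction (trans (sym (B⊆R ℓ Bℓ)) Rℓ) λ ()
        ... | false = refl

      fresh-step : ∀ {j} → BagBound i B → (4 ℕ.+ 2 * j) · μᵢ ≤ℚ V (v i) R → Reserve i (R ∖ B) (suc j)
      fresh-step {j} (inj₁ B≤μ) h = settled (subst (_≤ℚ VR′) (sym (odd-suc j μᵢ))
        (+-cancel-≤-dominated B≤μ (ℚ.≤-trans h (ℚ.≤-reflexive split))))
      fresh-step {j} (inj₂ (ℓ , Bℓ , B≤μ+ℓ)) h = pending ℓ (B⊆R₀ ℓ Bℓ) R′ℓ (+-cancelˡ-≤ μᵢ (begin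
        μᵢ + (3 ℕ.+ 2 * j) · μᵢ  ≤⟨ h ⟩
        V (v i) R               ≡⟨ split ⟩
        VB + VR′                ≤⟨ ℚ.+-monoˡ-≤ VR′ B≤μ+ℓ ⟩
        μᵢ + v i ℓ + VR′        ≡⟨ xy∙z≈xz∙y μᵢ (v i ℓ) VR′ ⟩
        μᵢ + VR′ + v i ℓ        ≡⟨ ℚ.+-assoc μᵢ VR′ (v i ℓ) ⟩
        μᵢ + (VR′ + v i ℓ)      ∎))
        where
        R′ℓ : (R ∖ B) ℓ ≡ false
        R′ℓ rewrite Bℓ = Bool.∧-zeroʳ (R ℓ)

      reserve-step : ∀ {j} → BagBound i B → Reserve i R (suc j) → Reserve i (R ∖ B) j
      reserve-step {j} bound (settled h)          = settled (settled-step {j} bound h)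
      reserve-step {j} bound (pending ℓ R₀ℓ Rℓ h) = settled (pending-step {j} bound R₀ℓ Rℓ h)
      reserve-step bound (fresh h)            = fresh-step bound h

    fill-bags : ∀ j L R → length L ≡ suc j → R ⊆ R₀ →
                All (λ i → Small i × Reserve i R j) L → Allocation L R
    fill-bags zero    (i ∷ [])    R _  _    ((_ , reserve) ∷ []) = lone (reserve-final reserve)
    fill-bags (suc j) L@(_ ∷ _) R len R⊆R₀ states@((small , reserve) ∷ _) =
      assign taker bag⊆R (fill-bags j (L ─ taker) (R ∖ bag) len′ R′⊆R₀
        (─⁺ taker (All.zipWith step (states , bounded))))
      where
      open Bag (find-bag (here (reserve-liked small reserve)))
      len′ : length (L ─ taker) ≡ suc j
      len′ = trans (length-removeAt L (Any.index taker)) (cong ℕ.pred len)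
      R′⊆R₀ : R ∖ bag ⊆ R₀
      R′⊆R₀ o h = R⊆R₀ o (Bool.∧-conicalˡ (R o) _ h)
      step : ∀ {i} → (Small i × Reserve i R (suc j)) × BagBound i bag → Small i × Reserve i (R ∖ bag) j
      step ((small , reserve) , bound) = small , reserve-step small R⊆R₀ bag⊆R bound reserve

  PairLiked : List (Fin n) → Bundle m → Set
  PairLiked L R = Σ (Fin m) λ x → Σ (Fin m) λ y →
    R x ≡ true × R y ≡ true × Any (λ i → Likes i (⁅ x ⁆ ∪ ⁅ y ⁆)) L

  pair-liked? : ∀ L R → Dec (PairLiked L R)
  pair-liked? L R = Fin.any? λ x → Fin.any? λ y →
    (R x Bool.≟ true) ×-dec (R y Bool.≟ true) ×-dec Any.any? (λ i → likes? i (⁅ x ⁆ ∪ ⁅ y ⁆)) L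

  no-pair-liked : ∀ {L R} → ¬ PairLiked L R → All (BagFilling.Small R) L
  no-pair-liked {L} none = All.tabulate λ i∈L x y Rx Ry →
    ℚ.≰⇒> λ i⊒xy → none (x , y , Rx , Ry , lose i∈L i⊒xy)

  even-suc : ∀ k → 2 ℕ.+ 2 * suc k ≡ 4 ℕ.+ 2 * k
  even-suc k = cong (2 ℕ.+_) (ℕ.*-suc 2 k)

  divide : ∀ k L R → length L ≡ 2 ℕ.+ k → All (λ i → Pieces i R (2 ℕ.+ 2 * k)) L → Allocation L R
  divide zero    (a ∷ b ∷ []) R _ (pa ∷ pb ∷ []) = cut-and-choose pa pb
  divide (suc k) L R len pcs with pair-liked? L R
  ... | yes (x , y , Rx , Ry , p) =
    assign p (⁅⁆∪-⊆ Rx (⁅⁆-⊆ Ry)) (divide k (L ─ p) (R ∖ (⁅ x ⁆ ∪ ⁅ y ⁆)) len′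
      (─⁺ p (All.map (λ pc → pieces-avoiding (subst (Pieces _ R) (even-suc k) pc) x y) pcs)))
    where
    len′ : length (L ─ p) ≡ 2 ℕ.+ k
    len′ = trans (length-removeAt L (Any.index p)) (cong ℕ.pred len)
  ... | no none = BagFilling.fill-bags R (2 ℕ.+ k) L R len (λ _ Ro → Ro)
    (All.zipWith start (no-pair-liked none , pcs))
    where
    start : ∀ {i} → BagFilling.Small R i × Pieces i R (2 ℕ.+ 2 * suc k) →
            BagFilling.Small R i × BagFilling.Reserve R i R (2 ℕ.+ k)
    start {i} (small , pc) =
      small , BagFilling.fresh (subst (_≤ℚ V (v i) R) (cong (_· μ i) (even-suc k)) (pieces-value pc))

theorem1p7 : (m n : ℕ) → 2 ≤ n → (v : Fin n → Fin m → ℚ) →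
    ((i : Fin n) (j : Fin m) → 0ℚ ≤ℚ v i j) →
    Σ (Fin m → Fin n) λ A →
    (i : Fin n) → MMS-≤ 1 (2 * n ∸ 2) (v i) (V (v i) (bundle A i))
theorem1p7 m 1 (s≤s ()) v v≥0
theorem1p7 m (suc (suc k)) _ v v≥0 = A , guarantee
  where
  n : ℕ
  n = suc (suc k)
  D≡ : 2 * n ∸ 2 ≡ 2 ℕ.+ 2 * k
  D≡ = cong (_∸ 2) (ℕ.*-distribˡ-+ 2 2 k)
  k₀ : Fin (2 * n ∸ 2)
  k₀ = subst Fin (sym D≡) zero
  module MMS (i : Fin n) = Maximin (v i) k₀
  open Protocol v v≥0 MMS.mms (λ i → V-nonneg (v≥0 i) _)
  allocation : Allocation (allFin n) full
  allocation = divide k (allFin n) full (length-tabulate (λ i → i)) (All.tabulate⁺ λ i →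
    subst (Pieces i full) D≡ (partition-pieces (MMS.maximin i) (MMS.mms-≤-maximin i)))
  A : Fin m → Fin n
  A = proj₁ allocation
  received : ∀ i → MMS.mms i ≤ℚ V (v i) (bundle A i)
  received i = subst (MMS.mms i ≤ℚ_) (V-cong (v i) λ o → sym (isYes≗does (A o ≟ i)))
    (All.lookup (proj₂ allocation) (∈-allFin i))
  guarantee : ∀ i → MMS-≤ 1 (2 * n ∸ 2) (v i) (V (v i) (bundle A i))
  guarantee i = MMS-≤-intro (v i) λ P → map₂ (λ Pl≤μ → ℚ.≤-trans Pl≤μ (received i)) (MMS.mms-bound i P)
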